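{- Let $r\in\mathbb{Z}_{\ge1}$ and $\mathbf{a}\in\mathbb{Z}^{r+1}$. If $[\mathbf{D}_{r+1}\ \mathbf{a}]$ is a $3$-modular matrix with non-zero, pairwise non-parallel columns and rows that sum to $\mathbf{0}$, then, up to permuting entries and multiplying by $-1$, the vector $\underline{\mathbf{a}}$ of non-zero entries of $\mathbf{a}$ is one of $(-3,2,1)^\top$, $(-2,1,1)^\top$, $(-3,1,1,1)^\top$, $(-2,2,-1,1)^\top$, $(-1,-1,1,1)^\top$, $(-2,-1,1,1,1)^\top$, $(-1,-1,-1,1,1,1)^\top$.
   Context: $\mathbf{D}_{r+1}$ is the $(r+1)\times\binom{r+1}{2}$ matrix with columns $\mathbf{e}_i-\mathbf{e}_j$ for $1\le i<j\le r+1$. An integer matrix $\mathbf{A}$ is $3$-modular if every $\operatorname{rank}(\mathbf{A})\times\operatorname{rank}(\mathbf{A})$ submatrix has determinant of absolute value at most $3$. Columns are parallel if linearly dependent. For a vector $\mathbf{x}$, $\underline{\mathbf{x}}$ denotes the subvector of $\mathbf{x}$ consisting of the entries indexed by its support $\{i: x_i\neq0\}$. -}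

module Defs where

open import Data.Nat using (ℕ; zero; suc; _<_)
open import Data.Integer using (ℤ; +_; -_; _+_; _*_; _-_; ∣_∣; 0ℤ; 1ℤ; -1ℤ)
open import Data.Integer.Properties using () renaming (_≟_ to _≟ℤ_)
open import Data.Fin using (Fin; zero; suc; punchIn) renaming (_<_ to _<ᶠ_)
open import Data.Fin.Properties using () renaming (_≟_ to _≟ᶠ_)
open import Data.Product using (Σ; _×_; _,_; ∃; ∃-syntax)
open import Data.Sum using (_⊎_; inj₁; inj₂)
open import Data.Unit using (⊤; tt)
open import Data.List using (List; []; _∷_; filter)
open import Data.Vec.Functional using (toList)
open import Relation.Binary.PropositionalEquality using (_≡_)
open import Relation.Nullary using (¬_; yes; no; ¬?)
open import Function.Definitions using (Injective)

∑ : ∀ {n} → (Fin n → ℤ) → ℤ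
∑ {zero}  f = 0ℤ
∑ {suc n} f = f zero + ∑ (λ i → f (suc i))

sgn : ∀ {n} → Fin n → ℤ
sgn zero    = 1ℤ
sgn (suc i) = - sgn i

det : ∀ {n} → (Fin n → Fin n → ℤ) → ℤ
det {zero}  M = 1ℤ
det {suc n} M = ∑ (λ j → sgn j * (M zero j * det (λ i k → M (suc i) (punchIn j k))))

Mat : ℕ → Set → Set
Mat m C = Fin m → C → ℤ

sub : ∀ {m k} {C : Set} → Mat m C → (Fin k → Fin m) → (Fin k → C) → Fin k → Fin k → ℤ
sub M ρ κ i j = M (ρ i) (κ j)

Minor : ∀ {m} → Set → ℕ → Set
Minor {m} C k = Σ (Fin k → Fin m) (λ ρ → Injective _≡_ _≡_ ρ) × Σ (Fin k → C) (λ κ → Injective _≡_ _≡_ κ)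

minorDet : ∀ {m k} {C : Set} → Mat m C → Minor {m} C k → ℤ
minorDet M ((ρ , _) , (κ , _)) = det (sub M ρ κ)

IsRank : ∀ {m} {C : Set} → Mat m C → ℕ → Set
IsRank {m} {C} M k =
  (Σ (Minor {m} C k) λ s → ¬ (minorDet M s ≡ 0ℤ)) ×
  (∀ l → k < l → (s : Minor {m} C l) → minorDet M s ≡ 0ℤ)

IsModular : ∀ {m} {C : Set} → ℕ → Mat m C → Set
IsModular {m} {C} Δ M = ∀ k → IsRank M k → (s : Minor {m} C k) → ∣ minorDet M s ∣ Data.Nat.≤ Δ

col : ∀ {m} {C : Set} → Mat m C → C → Fin m → ℤ
col M c i = M i c

IsZeroVec : ∀ {m} → (Fin m → ℤ) → Set
IsZeroVec u = ∀ i → u i ≡ 0ℤ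

Parallel : ∀ {m} → (Fin m → ℤ) → (Fin m → ℤ) → Set
Parallel u v = Σ ℤ λ λ₁ → Σ ℤ λ μ → ¬ (λ₁ ≡ 0ℤ × μ ≡ 0ℤ) × (∀ i → λ₁ * u i + μ * v i ≡ 0ℤ)

NonZeroColumns : ∀ {m} {C : Set} → Mat m C → Set
NonZeroColumns M = ∀ c → ¬ IsZeroVec (col M c)

PairwiseNonParallel : ∀ {m} {C : Set} → Mat m C → Set
PairwiseNonParallel M = ∀ c c′ → ¬ (c ≡ c′) → ¬ Parallel (col M c) (col M c′)

RowsSumToZero : ∀ {m} {C : Set} → Mat m C → Set
RowsSumToZero M = ∀ c → ∑ (λ i → M i c) ≡ 0ℤ

e : ∀ {n} → Fin n → Fin n → ℤ
e i k with i ≟ᶠ k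
... | yes _ = 1ℤ
... | no  _ = 0ℤ

DCol : ℕ → Set
DCol n = Σ (Fin n × Fin n) (λ { (i , j) → i <ᶠ j })

D : ∀ n → Mat n (DCol n)
D n k ((i , j) , _) = e i k - e j k

Daug : ∀ n → (Fin n → ℤ) → Mat n (DCol n ⊎ ⊤)
Daug n a k (inj₁ c)  = D n k c
Daug n a k (inj₂ tt) = a k

supp : ∀ {n} → (Fin n → ℤ) → List ℤ
supp x = filter (λ z → ¬? (z ≟ℤ 0ℤ)) (toList x)

L₁ L₂ L₃ L₄ L₅ L₆ L₇ : List ℤ
L₁ = - (+ 3) ∷ + 2 ∷ + 1 ∷ []
L₂ = - (+ 2) ∷ + 1 ∷ + 1 ∷ []
L₃ = - (+ 3) ∷ + 1 ∷ + 1 ∷ + 1 ∷ []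
L₄ = - (+ 2) ∷ + 2 ∷ - (+ 1) ∷ + 1 ∷ []
L₅ = - (+ 1) ∷ - (+ 1) ∷ + 1 ∷ + 1 ∷ []
L₆ = - (+ 2) ∷ - (+ 1) ∷ + 1 ∷ + 1 ∷ + 1 ∷ []
L₇ = - (+ 1) ∷ - (+ 1) ∷ - (+ 1) ∷ + 1 ∷ + 1 ∷ + 1 ∷ []

-- The matrix [D a] has rank r: the columns e₀ − eₖ give an r × r minor ±1, and every
-- (r+1) × (r+1) minor vanishes because the rows sum to zero.  Let P be the sum of the
-- positive entries of a and K the set of vertices whose entry lies in the other sign class
-- (positive / non-positive) than a₀; as a sums to zero, Σ_{v∈K} aᵥ = ±P.  If K has a least
-- element w, delete row 0 and take the column a together with the edges from w to the rest
-- of K and from 0 to all remaining vertices: this r × r minor is bordered by −I, so its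
-- determinant is ±Σ_{v∈K} aᵥ.  Hence 3-modularity forces P ≤ 3, so the positive entries and
-- the absolute values of the negative entries form two compositions of the same P ≤ 3.
-- Running through the pairs of such compositions leaves the seven lists, a = 0, and
-- a = c (eᵢ − eⱼ); the last two are excluded by the hypotheses on the columns.

module Submission where

open import Defs
open import Data.Nat using (ℕ; suc; _≤_)
open import Data.Integer using (ℤ; _*_; 1ℤ; -1ℤ)
open import Data.Fin using (Fin)
open import Data.List using (List; map)
open import Data.List.Relation.Binary.Permutation.Propositional using (_↭_)
open import Data.Product using (Σ; _×_)
open import Data.Sum using (_⊎_)
open import Relation.Binary.PropositionalEquality using (_≡_)

open import Data.Bool using (Bool; true; false; not; if_then_else_; T)
open import Data.Bool.Properties using (¬-not; not-¬) renaming (_≟_ to _≟ᵇ_)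
open import Data.Nat using (zero; z≤n; s≤s; _<_)
import Data.Nat.Properties as ℕ
open import Data.Nat.ListAction using (sum)
open import Data.Integer using (+_; -_; _+_; _-_; _^_; ∣_∣; 0ℤ; +[1+_]; -[1+_])
open import Data.Integer.Properties
  using (+-identityˡ; +-identityʳ; *-identityˡ; *-identityʳ; *-zeroˡ; *-zeroʳ; *-comm; *-assoc; *-distribˡ-+;
         +-inverseʳ; neg-involutive; neg-distribˡ-*; neg-distribʳ-*; -1*i≡-i; ∣-i∣≡∣i∣; i^n≡0⇒i≡0;
         pos-+; neg-distrib-+; +-injective; i-j≡0⇒i≡j)
  renaming (_≟_ to _≟ℤ_)
open import Data.Integer.Tactic.RingSolver using (solve-∀)
open import Data.Fin using (zero; suc; punchIn; punchOut; fromℕ<) renaming (_<_ to _<ᶠ_; _≤_ to _≤ᶠ_)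
open import Data.Fin.Properties
  using (suc-injective; punchInᵢ≢i; punchIn-injective; punchIn-punchOut; punchOut-punchIn; punchOut-cong;
         punchOut-injective; ¬∀⟶∃¬-smallest; injective⇒≤; toℕ-injective; toℕ-inject; toℕ-fromℕ<; ≤∧≢⇒<; any?)
  renaming (_≟_ to _≟ᶠ_)
open import Data.List using ([]; _∷_; _++_; foldr; length)
open import Data.List.Properties using (≡-dec; ∷-injectiveˡ; ∷-injectiveʳ)
open import Data.List.Membership.DecPropositional _≟ℤ_ using (_∈?_)
open import Data.List.Membership.Propositional.Properties using (∈-∃++)
open import Data.List.Relation.Binary.Permutation.Propositional using (prep; ↭-refl; ↭-sym; ↭-trans)
open import Data.List.Relation.Binary.Permutation.Propositional.Properties using (shift; map⁺; ↭-length; ↭-empty-inv)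
open import Data.Maybe using (Maybe; just; nothing; is-just; to-witness-T)
import Data.Maybe as Maybe
open import Data.Product using (∃; _,_; proj₁; proj₂)
open import Data.Sum using (inj₁; inj₂)
open import Data.Sum.Properties using (inj₁-injective)
open import Data.Unit using (⊤; tt)
open import Data.Vec.Functional using (toList)
open import Function using (_∘_)
open import Function.Definitions using (Injective)
open import Relation.Binary.PropositionalEquality using (_≢_; refl; sym; trans; cong; cong₂; subst; module ≡-Reasoning)
open import Relation.Nullary using (Dec; yes; no; contradiction)
open import Relation.Nullary.Decidable using (True; toWitness; _⊎-dec_)

-- Finite sums and unit vectors

∑-cong : ∀ {n} {f g : Fin n → ℤ} → (∀ i → f i ≡ g i) → ∑ f ≡ ∑ g
∑-cong {zero}  f≗g = refl
∑-cong {suc n} f≗g = cong₂ _+_ (f≗g zero) (∑-cong (f≗g ∘ suc))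

∑-0 : ∀ {n} {f : Fin n → ℤ} → (∀ i → f i ≡ 0ℤ) → ∑ f ≡ 0ℤ
∑-0 {zero}  f≗0 = refl
∑-0 {suc n} f≗0 = cong₂ _+_ (f≗0 zero) (∑-0 (f≗0 ∘ suc))

∑-distrib-+ : ∀ {n} (f g : Fin n → ℤ) → ∑ (λ i → f i + g i) ≡ ∑ f + ∑ g
∑-distrib-+ {zero}  f g = refl
∑-distrib-+ {suc n} f g =
  trans (cong (_+_ (f zero + g zero)) (∑-distrib-+ (f ∘ suc) (g ∘ suc)))
        (interchange (f zero) (g zero) (∑ (f ∘ suc)) (∑ (g ∘ suc)))
  where
  interchange : ∀ a b c d → (a + b) + (c + d) ≡ (a + c) + (b + d)
  interchange = solve-∀

*-distribˡ-∑ : ∀ {n} c (f : Fin n → ℤ) → c * ∑ f ≡ ∑ (λ i → c * f i)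
*-distribˡ-∑ {zero}  c f = *-zeroʳ c
*-distribˡ-∑ {suc n} c f =
  trans (*-distribˡ-+ c (f zero) (∑ (f ∘ suc))) (cong (_+_ (c * f zero)) (*-distribˡ-∑ c (f ∘ suc)))

∑-neg : ∀ {n} (f : Fin n → ℤ) → ∑ (λ i → - f i) ≡ - ∑ f
∑-neg f = begin
  ∑ (λ i → - f i)       ≡⟨ ∑-cong (λ i → sym (-1*i≡-i (f i))) ⟩
  ∑ (λ i → -1ℤ * f i)   ≡⟨ *-distribˡ-∑ -1ℤ f ⟨
  -1ℤ * ∑ f             ≡⟨ -1*i≡-i (∑ f) ⟩
  - ∑ f                 ∎
  where open ≡-Reasoning

∑-comm : ∀ {m n} (f : Fin m → Fin n → ℤ) → ∑ (λ i → ∑ (f i)) ≡ ∑ (λ j → ∑ (λ i → f i j))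
∑-comm {zero} {n} f = sym (∑-0 {n} (λ _ → refl))
∑-comm {suc m} f =
  trans (cong (_+_ (∑ (f zero))) (∑-comm (f ∘ suc))) (sym (∑-distrib-+ (f zero) (λ j → ∑ (λ i → f (suc i) j))))

∑-remove : ∀ {n} (f : Fin (suc n) → ℤ) i → ∑ f ≡ f i + ∑ (λ k → f (punchIn i k))
∑-remove f zero = refl
∑-remove {suc n} f (suc i) =
  trans (cong (_+_ (f zero)) (∑-remove (f ∘ suc) i)) (swap (f zero) (f (suc i)) _)
  where
  swap : ∀ a b c → a + (b + c) ≡ b + (a + c)
  swap = solve-∀

∑-reindex : ∀ {n} (ρ : Fin n → Fin n) → Injective _≡_ _≡_ ρ → (f : Fin n → ℤ) → ∑ (f ∘ ρ) ≡ ∑ f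
∑-reindex {zero}  ρ ρ-inj f = refl
∑-reindex {suc n} ρ ρ-inj f = begin
  f (ρ zero) + ∑ (f ∘ ρ ∘ suc)
    ≡⟨ cong (_+_ (f (ρ zero))) (∑-cong (λ i → cong f (punchIn-punchOut (ρ₀≢ρ i)))) ⟨
  f (ρ zero) + ∑ (f ∘ punchIn (ρ zero) ∘ ρ′)
    ≡⟨ cong (_+_ (f (ρ zero))) (∑-reindex ρ′ ρ′-inj (f ∘ punchIn (ρ zero))) ⟩
  f (ρ zero) + ∑ (f ∘ punchIn (ρ zero))
    ≡⟨ ∑-remove f (ρ zero) ⟨
  ∑ f
    ∎
  where
  open ≡-Reasoning
  ρ₀≢ρ : ∀ i → ρ zero ≢ ρ (suc i)
  ρ₀≢ρ i eq with () ← ρ-inj eq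
  ρ′ : Fin n → Fin n
  ρ′ i = punchOut (ρ₀≢ρ i)
  ρ′-inj : Injective _≡_ _≡_ ρ′
  ρ′-inj {i} {j} eq = suc-injective (ρ-inj (punchOut-injective (ρ₀≢ρ i) (ρ₀≢ρ j) eq))

e-diag : ∀ {n} (i : Fin n) → e i i ≡ 1ℤ
e-diag i with i ≟ᶠ i
... | yes _  = refl
... | no i≢i = contradiction refl i≢i

e-offDiag : ∀ {n} {i k : Fin n} → i ≢ k → e i k ≡ 0ℤ
e-offDiag {i = i} {k} i≢k with i ≟ᶠ k
... | yes i≡k = contradiction i≡k i≢k
... | no _    = refl

e-injection : ∀ {m n} {f : Fin m → Fin n} → Injective _≡_ _≡_ f → ∀ i k → e (f i) (f k) ≡ e i k
e-injection {f = f} f-inj i k with i ≟ᶠ k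
... | yes refl = e-diag (f i)
... | no i≢k   = e-offDiag {i = f i} {f k} (i≢k ∘ f-inj)

∑-*-e : ∀ {n} (c : Fin n → ℤ) l → ∑ (λ i → c i * e l i) ≡ c l
∑-*-e {suc n} c l = begin
  ∑ (λ i → c i * e l i)                                      ≡⟨ ∑-remove (λ i → c i * e l i) l ⟩
  c l * e l l + ∑ (λ k → c (punchIn l k) * e l (punchIn l k)) ≡⟨ cong₂ _+_ (cong (c l *_) (e-diag l)) (∑-0 off) ⟩
  c l * 1ℤ + 0ℤ                                              ≡⟨ trans (+-identityʳ _) (*-identityʳ (c l)) ⟩
  c l                                                        ∎
  where
  open ≡-Reasoning
  off : ∀ k → c (punchIn l k) * e l (punchIn l k) ≡ 0ℤ
  off k = trans (cong (c (punchIn l k) *_) (e-offDiag (punchInᵢ≢i l k ∘ sym))) (*-zeroʳ (c (punchIn l k)))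

-- Determinants

Square : ℕ → Set
Square n = Fin n → Fin n → ℤ

minor : ∀ {n} → Square (suc n) → Fin (suc n) → Square n
minor M j i k = M (suc i) (punchIn j k)

withRow₀ : ∀ {n} → (Fin (suc n) → ℤ) → Square (suc n) → Square (suc n)
withRow₀ v M zero    = v
withRow₀ v M (suc i) = M (suc i)

det-cong : ∀ {n} {M N : Square n} → (∀ i j → M i j ≡ N i j) → det M ≡ det N
det-cong {zero}  M≗N = refl
det-cong {suc n} M≗N =
  ∑-cong (λ j → cong₂ (λ x d → sgn j * (x * d)) (M≗N zero j) (det-cong (λ i k → M≗N (suc i) (punchIn j k))))

det-row₀-single : ∀ {n} (M : Square (suc n)) → (∀ k → M zero (suc k) ≡ 0ℤ) →
                  det M ≡ M zero zero * det (minor M zero)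
det-row₀-single M row₀≡0 =
  trans (cong₂ _+_ (*-identityˡ (M zero zero * det (minor M zero))) (∑-0 vanish)) (+-identityʳ _)
  where
  vanish : ∀ k → sgn (suc k) * (M zero (suc k) * det (minor M (suc k))) ≡ 0ℤ
  vanish k = trans (cong (λ x → sgn (suc k) * (x * det (minor M (suc k)))) (row₀≡0 k))
                   (trans (cong (sgn (suc k) *_) (*-zeroˡ (det (minor M (suc k))))) (*-zeroʳ (sgn (suc k))))

punchIn-punchOut-comm : ∀ {n} (a b : Fin (suc (suc n))) (a≢b : a ≢ b) (b≢a : b ≢ a) l →
                        punchIn a (punchIn (punchOut a≢b) l) ≡ punchIn b (punchIn (punchOut b≢a) l)
punchIn-punchOut-comm zero    zero    a≢b _ l = contradiction refl a≢b
punchIn-punchOut-comm zero    (suc b) _   _ l = refl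
punchIn-punchOut-comm (suc a) zero    _   _ l = refl
punchIn-punchOut-comm {zero}  (suc a) (suc b) _ _ ()
punchIn-punchOut-comm {suc n} (suc a) (suc b) _ _ zero    = refl
punchIn-punchOut-comm {suc n} (suc a) (suc b) _ _ (suc l) = cong suc (punchIn-punchOut-comm a b _ _ l)

sgn-punchOut-anti : ∀ {n} (a b : Fin (suc (suc n))) (a≢b : a ≢ b) (b≢a : b ≢ a) →
                    sgn a * sgn (punchOut a≢b) ≡ - (sgn b * sgn (punchOut b≢a))
sgn-punchOut-anti zero    zero    a≢b _ = contradiction refl a≢b
sgn-punchOut-anti zero    (suc b) _   _ = lemma (sgn b)
  where
  lemma : ∀ x → 1ℤ * x ≡ - ((- x) * 1ℤ)
  lemma = solve-∀
sgn-punchOut-anti (suc a) zero    _   _ = lemma (sgn a)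
  where
  lemma : ∀ x → (- x) * 1ℤ ≡ - (1ℤ * x)
  lemma = solve-∀
sgn-punchOut-anti {zero}  (suc zero) (suc zero) a≢b _ = contradiction refl a≢b
sgn-punchOut-anti {suc n} (suc a)    (suc b)    _   _ =
  trans (lemma (sgn a) _) (trans (sgn-punchOut-anti a b _ _) (sym (cong -_ (lemma (sgn b) _))))
  where
  lemma : ∀ x y → (- x) * (- y) ≡ x * y
  lemma = solve-∀

-- The coefficient of M₀ₐ M₁ᵦ in det M, where R holds the rows of M below the first two.
pairCofactor : ∀ {m} → (Fin m → Fin (suc (suc m)) → ℤ) → Fin (suc (suc m)) → Fin (suc (suc m)) → ℤ
pairCofactor R a b with a ≟ᶠ b
... | yes _  = 0ℤ
... | no a≢b = sgn a * sgn (punchOut a≢b) * det (λ i l → R i (punchIn a (punchIn (punchOut a≢b) l)))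

pairCofactor-diag : ∀ {m} (R : Fin m → Fin (suc (suc m)) → ℤ) a → pairCofactor R a a ≡ 0ℤ
pairCofactor-diag R a with a ≟ᶠ a
... | yes _  = refl
... | no a≢a = contradiction refl a≢a

pairCofactor-punchIn : ∀ {m} (R : Fin m → Fin (suc (suc m)) → ℤ) a k →
                       pairCofactor R a (punchIn a k) ≡ sgn a * sgn k * det (λ i l → R i (punchIn a (punchIn k l)))
pairCofactor-punchIn R a k with a ≟ᶠ punchIn a k
... | yes a≡a′ = contradiction (sym a≡a′) (punchInᵢ≢i a k)
... | no a≢a′  = cong (λ k′ → sgn a * sgn k′ * det (λ i l → R i (punchIn a (punchIn k′ l))))
                      (trans (punchOut-cong a refl) (punchOut-punchIn a))

pairCofactor-anti : ∀ {m} (R : Fin m → Fin (suc (suc m)) → ℤ) a b → pairCofactor R a b ≡ - pairCofactor R b a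
pairCofactor-anti R a b with a ≟ᶠ b | b ≟ᶠ a
... | yes _    | yes _    = refl
... | yes refl | no b≢a   = contradiction refl b≢a
... | no a≢b   | yes refl = contradiction refl a≢b
... | no a≢b   | no b≢a   =
  trans (cong₂ _*_ (sgn-punchOut-anti a b a≢b b≢a)
                   (det-cong (λ i l → cong (R i) (punchIn-punchOut-comm a b a≢b b≢a l))))
        (sym (neg-distribˡ-* (sgn b * sgn (punchOut b≢a)) (det (λ i l → R i (punchIn b (punchIn (punchOut b≢a) l))))))

lowerRows : ∀ {m} → Square (suc (suc m)) → Fin m → Fin (suc (suc m)) → ℤ
lowerRows M i = M (suc (suc i))

det-expand₀₁ : ∀ {m} (M : Square (suc (suc m))) →
               det M ≡ ∑ (λ a → ∑ (λ b → M zero a * M (suc zero) b * pairCofactor (lowerRows M) a b))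
det-expand₀₁ M = ∑-cong expand
  where
  open ≡-Reasoning
  C : Fin _ → Fin _ → ℤ
  C a k = det (minor (minor M a) k)
  expand : ∀ a → sgn a * (M zero a * det (minor M a)) ≡ ∑ (λ b → M zero a * M (suc zero) b * pairCofactor (lowerRows M) a b)
  expand a = begin
    sgn a * (M zero a * ∑ g)                ≡⟨ cong (sgn a *_) (*-distribˡ-∑ (M zero a) g) ⟩
    sgn a * ∑ (λ k → M zero a * g k)        ≡⟨ *-distribˡ-∑ (sgn a) (λ k → M zero a * g k) ⟩
    ∑ (λ k → sgn a * (M zero a * g k))      ≡⟨ ∑-cong regroup ⟩
    ∑ (λ k → h (punchIn a k))               ≡⟨ +-identityˡ (∑ (λ k → h (punchIn a k))) ⟨
    0ℤ + ∑ (λ k → h (punchIn a k))          ≡⟨ cong (_+ ∑ (λ k → h (punchIn a k))) h-diag ⟨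
    h a + ∑ (λ k → h (punchIn a k))         ≡⟨ ∑-remove h a ⟨
    ∑ h                                     ∎
    where
    g : Fin _ → ℤ
    g k = sgn k * (M (suc zero) (punchIn a k) * C a k)
    h : Fin _ → ℤ
    h b = M zero a * M (suc zero) b * pairCofactor (lowerRows M) a b
    regroup : ∀ k → sgn a * (M zero a * g k) ≡ h (punchIn a k)
    regroup k = trans (ring (sgn a) (M zero a) (sgn k) (M (suc zero) (punchIn a k)) (C a k))
                      (cong (M zero a * M (suc zero) (punchIn a k) *_) (sym (pairCofactor-punchIn (lowerRows M) a k)))
      where
      ring : ∀ s x t y d → s * (x * (t * (y * d))) ≡ x * y * (s * t * d)
      ring = solve-∀
    h-diag : h a ≡ 0ℤ
    h-diag = trans (cong (M zero a * M (suc zero) a *_) (pairCofactor-diag (lowerRows M) a)) (*-zeroʳ (M zero a * M (suc zero) a))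

swap₀₁ : ∀ {n} → Fin (suc (suc n)) → Fin (suc (suc n))
swap₀₁ zero          = suc zero
swap₀₁ (suc zero)    = zero
swap₀₁ (suc (suc i)) = suc (suc i)

det-swap₀₁ : ∀ {m} (M : Square (suc (suc m))) → det (M ∘ swap₀₁) ≡ - det M
det-swap₀₁ M = begin
  det (M ∘ swap₀₁)
    ≡⟨ det-expand₀₁ (M ∘ swap₀₁) ⟩
  ∑ (λ a → ∑ (λ b → M (suc zero) a * M zero b * pairCofactor (lowerRows M) a b))
    ≡⟨ ∑-comm (λ a b → M (suc zero) a * M zero b * pairCofactor (lowerRows M) a b) ⟩
  ∑ (λ b → ∑ (λ a → M (suc zero) a * M zero b * pairCofactor (lowerRows M) a b))
    ≡⟨ ∑-cong (λ b → ∑-cong (λ a → trans (cong (M (suc zero) a * M zero b *_) (pairCofactor-anti (lowerRows M) a b))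
                                         (swapped (M (suc zero) a) (M zero b) (pairCofactor (lowerRows M) b a)))) ⟩
  ∑ (λ b → ∑ (λ a → - (M zero b * M (suc zero) a * pairCofactor (lowerRows M) b a)))
    ≡⟨ ∑-cong (λ b → ∑-neg (λ a → M zero b * M (suc zero) a * pairCofactor (lowerRows M) b a)) ⟩
  ∑ (λ b → - ∑ (λ a → M zero b * M (suc zero) a * pairCofactor (lowerRows M) b a))
    ≡⟨ ∑-neg (λ b → ∑ (λ a → M zero b * M (suc zero) a * pairCofactor (lowerRows M) b a)) ⟩
  - ∑ (λ b → ∑ (λ a → M zero b * M (suc zero) a * pairCofactor (lowerRows M) b a))
    ≡⟨ cong -_ (det-expand₀₁ M) ⟨
  - det M
    ∎
  where
  open ≡-Reasoning
  swapped : ∀ x y c → x * y * (- c) ≡ - (y * x * c)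
  swapped = solve-∀

Alternating : ℕ → Set
Alternating n = (M : Square n) {p q : Fin n} → p ≢ q → (∀ j → M p j ≡ M q j) → det M ≡ 0ℤ

det-equalLowerRows : ∀ {n} → Alternating n → (M : Square (suc n)) {p q : Fin n} → p ≢ q →
                     (∀ j → M (suc p) j ≡ M (suc q) j) → det M ≡ 0ℤ
det-equalLowerRows alternating M p≢q rows≡ = ∑-0 vanish
  where
  vanish : ∀ j → sgn j * (M zero j * det (minor M j)) ≡ 0ℤ
  vanish j = begin
    sgn j * (M zero j * det (minor M j)) ≡⟨ cong (λ d → sgn j * (M zero j * d)) minor≡0 ⟩
    sgn j * (M zero j * 0ℤ)              ≡⟨ cong (sgn j *_) (*-zeroʳ (M zero j)) ⟩
    sgn j * 0ℤ                           ≡⟨ *-zeroʳ (sgn j) ⟩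
    0ℤ                                   ∎
    where
    open ≡-Reasoning
    minor≡0 : det (minor M j) ≡ 0ℤ
    minor≡0 = alternating (minor M j) p≢q (rows≡ ∘ punchIn j)

i≡-i⇒i≡0 : ∀ {i} → i ≡ - i → i ≡ 0ℤ
i≡-i⇒i≡0 {+ zero}   _ = refl
i≡-i⇒i≡0 {+[1+ _ ]} ()
i≡-i⇒i≡0 { -[1+ _ ]} ()

det-equalRow₀ : ∀ {n} → Alternating (suc n) → (M : Square (suc (suc n))) (q : Fin (suc n)) →
                (∀ j → M zero j ≡ M (suc q) j) → det M ≡ 0ℤ
det-equalRow₀ alternating M zero rows≡ = i≡-i⇒i≡0 (trans (det-cong swap-invisible) (det-swap₀₁ M))
  where
  swap-invisible : ∀ i j → M i j ≡ M (swap₀₁ i) j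
  swap-invisible zero          j = rows≡ j
  swap-invisible (suc zero)    j = sym (rows≡ j)
  swap-invisible (suc (suc i)) j = refl
-- Swapping rows 0 and 1 turns the repetition of rows 0 and q + 2 into one below row 0.
det-equalRow₀ alternating M (suc q) rows≡ = begin
  det M                ≡⟨ neg-involutive (det M) ⟨
  - - det M            ≡⟨ cong -_ (det-swap₀₁ M) ⟨
  - det (M ∘ swap₀₁)   ≡⟨ cong -_ (det-equalLowerRows alternating (M ∘ swap₀₁) {zero} {suc q} (λ ()) rows≡) ⟩
  0ℤ                   ∎
  where open ≡-Reasoning

det-equalRows : ∀ {n} → Alternating n
det-equalRows {suc n}       M {zero}  {zero}  p≢q _     = contradiction refl p≢q
det-equalRows {suc n}       M {suc p} {suc q} p≢q rows≡ = det-equalLowerRows det-equalRows M (p≢q ∘ cong suc) rows≡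
det-equalRows {suc (suc n)} M {zero}  {suc q} _   rows≡ = det-equalRow₀ det-equalRows M q rows≡
det-equalRows {suc (suc n)} M {suc p} {zero}  _   rows≡ = det-equalRow₀ det-equalRows M p (sym ∘ rows≡)

det-addRows₀ : ∀ {n} (M : Square (suc n)) (c : Fin n → ℤ) →
               det (withRow₀ (λ j → M zero j + ∑ (λ i → c i * M (suc i) j)) M) ≡ det M
det-addRows₀ M c = begin
  ∑ (λ j → sgn j * ((M zero j + ∑ (λ i → c i * M (suc i) j)) * C j))
    ≡⟨ ∑-cong split ⟩
  ∑ (λ j → sgn j * (M zero j * C j) + ∑ (λ i → c i * term i j))
    ≡⟨ ∑-distrib-+ (λ j → sgn j * (M zero j * C j)) (λ j → ∑ (λ i → c i * term i j)) ⟩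
  det M + ∑ (λ j → ∑ (λ i → c i * term i j))
    ≡⟨ cong (_+_ (det M)) (∑-comm (λ j i → c i * term i j)) ⟩
  det M + ∑ (λ i → ∑ (λ j → c i * term i j))
    ≡⟨ cong (_+_ (det M)) (∑-0 copies-vanish) ⟩
  det M + 0ℤ
    ≡⟨ +-identityʳ (det M) ⟩
  det M
    ∎
  where
  open ≡-Reasoning
  C : Fin _ → ℤ
  C j = det (minor M j)
  term : Fin _ → Fin _ → ℤ
  term i j = sgn j * (M (suc i) j * C j)
  split : ∀ j → sgn j * ((M zero j + ∑ (λ i → c i * M (suc i) j)) * C j)
              ≡ sgn j * (M zero j * C j) + ∑ (λ i → c i * term i j)
  split j = begin
    sgn j * ((M zero j + ∑ (λ i → c i * M (suc i) j)) * C j)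
      ≡⟨ distribute (sgn j) (M zero j) (∑ (λ i → c i * M (suc i) j)) (C j) ⟩
    sgn j * (M zero j * C j) + sgn j * C j * ∑ (λ i → c i * M (suc i) j)
      ≡⟨ cong (_+_ (sgn j * (M zero j * C j))) (*-distribˡ-∑ (sgn j * C j) (λ i → c i * M (suc i) j)) ⟩
    sgn j * (M zero j * C j) + ∑ (λ i → sgn j * C j * (c i * M (suc i) j))
      ≡⟨ cong (_+_ (sgn j * (M zero j * C j))) (∑-cong (λ i → regroup (sgn j) (C j) (c i) (M (suc i) j))) ⟩
    sgn j * (M zero j * C j) + ∑ (λ i → c i * term i j)
      ∎
    where
    distribute : ∀ s x y d → s * ((x + y) * d) ≡ s * (x * d) + s * d * y
    distribute = solve-∀
    regroup : ∀ s d x y → s * d * (x * y) ≡ x * (s * (y * d))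
    regroup = solve-∀
  copies-vanish : ∀ i → ∑ (λ j → c i * term i j) ≡ 0ℤ
  copies-vanish i = begin
    ∑ (λ j → c i * term i j)               ≡⟨ *-distribˡ-∑ (c i) (term i) ⟨
    c i * det (withRow₀ (M (suc i)) M)     ≡⟨ cong (c i *_) (det-equalRows (withRow₀ (M (suc i)) M) {zero} {suc i} (λ ()) λ _ → refl) ⟩
    c i * 0ℤ                               ≡⟨ *-zeroʳ (c i) ⟩
    0ℤ                                     ∎

det-rowsSumToZero : ∀ {n} (M : Square (suc n)) → (∀ j → ∑ (λ i → M i j) ≡ 0ℤ) → det M ≡ 0ℤ
det-rowsSumToZero M columnSums≡0 = begin
  det M                                  ≡⟨ det-addRows₀ M (λ _ → 1ℤ) ⟨
  det M′                                 ≡⟨ det-row₀-single M′ (row′≡0 ∘ suc) ⟩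
  M′ zero zero * det (minor M zero)      ≡⟨ cong (_* det (minor M zero)) (row′≡0 zero) ⟩
  0ℤ * det (minor M zero)                ≡⟨ *-zeroˡ (det (minor M zero)) ⟩
  0ℤ                                     ∎
  where
  open ≡-Reasoning
  M′ : Square _
  M′ = withRow₀ (λ j → M zero j + ∑ (λ i → 1ℤ * M (suc i) j)) M
  row′≡0 : ∀ j → M′ zero j ≡ 0ℤ
  row′≡0 j = trans (cong (_+_ (M zero j)) (∑-cong (λ i → *-identityˡ (M (suc i) j)))) (columnSums≡0 j)

det-negIdentity : ∀ {n} (M : Square n) → (∀ i k → M i k ≡ - e k i) → det M ≡ -1ℤ ^ n
det-negIdentity {zero}  M M≡-I = refl
det-negIdentity {suc n} M M≡-I = begin
  det M                               ≡⟨ det-row₀-single M (λ k → M≡-I zero (suc k)) ⟩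
  M zero zero * det (minor M zero)    ≡⟨ cong₂ _*_ (trans (M≡-I zero zero) (cong -_ (e-diag {suc n} zero)))
                                                   (det-negIdentity (minor M zero) minor≡-I) ⟩
  -1ℤ * -1ℤ ^ n                       ∎
  where
  open ≡-Reasoning
  minor≡-I : ∀ i k → M (suc i) (suc k) ≡ - e k i
  minor≡-I i k = trans (M≡-I (suc i) (suc k)) (cong -_ (e-injection suc-injective k i))

∣-1^n*i∣≡∣i∣ : ∀ n i → ∣ -1ℤ ^ n * i ∣ ≡ ∣ i ∣
∣-1^n*i∣≡∣i∣ zero    i = cong ∣_∣ (*-identityˡ i)
∣-1^n*i∣≡∣i∣ (suc n) i = begin
  ∣ -1ℤ * -1ℤ ^ n * i ∣     ≡⟨ cong ∣_∣ (*-assoc -1ℤ (-1ℤ ^ n) i) ⟩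
  ∣ -1ℤ * (-1ℤ ^ n * i) ∣   ≡⟨ cong ∣_∣ (-1*i≡-i (-1ℤ ^ n * i)) ⟩
  ∣ - (-1ℤ ^ n * i) ∣       ≡⟨ ∣-i∣≡∣i∣ (-1ℤ ^ n * i) ⟩
  ∣ -1ℤ ^ n * i ∣           ≡⟨ ∣-1^n*i∣≡∣i∣ n i ⟩
  ∣ i ∣                     ∎
  where open ≡-Reasoning

det-bordered : ∀ {m} (M : Square (suc m)) → (∀ i k → M (suc i) (suc k) ≡ - e k i) →
               det M ≡ -1ℤ ^ m * (M zero zero + ∑ (λ k → M zero (suc k) * M (suc k) zero))
det-bordered {m} M lower≡-I = begin
  det M                                                   ≡⟨ det-addRows₀ M c ⟨
  det M′                                                  ≡⟨ det-row₀-single M′ cleared ⟩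
  M′ zero zero * det (minor M zero)                       ≡⟨ cong (M′ zero zero *_) (det-negIdentity (minor M zero) lower≡-I) ⟩
  M′ zero zero * -1ℤ ^ m                                  ≡⟨ *-comm (M′ zero zero) (-1ℤ ^ m) ⟩
  -1ℤ ^ m * (M zero zero + ∑ (λ k → c k * M (suc k) zero)) ∎
  where
  open ≡-Reasoning
  c : Fin m → ℤ
  c k = M zero (suc k)
  M′ : Square (suc m)
  M′ = withRow₀ (λ j → M zero j + ∑ (λ i → c i * M (suc i) j)) M
  cleared : ∀ l → M′ zero (suc l) ≡ 0ℤ
  cleared l = begin
    c l + ∑ (λ i → c i * M (suc i) (suc l))    ≡⟨ cong (_+_ (c l)) (∑-cong (λ i → cong (c i *_) (lower≡-I i l))) ⟩
    c l + ∑ (λ i → c i * - e l i)              ≡⟨ cong (_+_ (c l)) (∑-cong (λ i → sym (neg-distribʳ-* (c i) (e l i)))) ⟩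
    c l + ∑ (λ i → - (c i * e l i))            ≡⟨ cong (_+_ (c l)) (∑-neg (λ i → c i * e l i)) ⟩
    c l + - ∑ (λ i → c i * e l i)              ≡⟨ cong (λ x → c l + - x) (∑-*-e c l) ⟩
    c l + - c l                                ≡⟨ +-inverseʳ (c l) ⟩
    0ℤ                                         ∎

-- Minors of [D a]

largeMinors-vanish : ∀ {m} {C : Set} (A : Mat (suc m) C) → RowsSumToZero A →
                     ∀ l → m < l → (s : Minor {suc m} C l) → minorDet A s ≡ 0ℤ
largeMinors-vanish {m} A rowsSum l m<l ((ρ , ρ-inj) , (κ , _)) with ℕ.m≤n⇒m<n∨m≡n m<l
... | inj₁ 1+m<l = contradiction (injective⇒≤ ρ-inj) (ℕ.<⇒≱ 1+m<l)
... | inj₂ refl  = det-rowsSumToZero (sub A ρ κ)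
                     (λ j → trans (∑-reindex ρ ρ-inj (λ i → A i (κ j))) (rowsSum (κ j)))

Daug-rank : ∀ r (a : Fin (suc r) → ℤ) → RowsSumToZero (Daug (suc r) a) → IsRank (Daug (suc r) a) r
Daug-rank r a rowsSum = (negIdentityMinor , det≢0) , largeMinors-vanish (Daug (suc r) a) rowsSum
  where
  edge₀ : Fin r → DCol (suc r) ⊎ ⊤
  edge₀ k = inj₁ ((zero , suc k) , s≤s z≤n)
  edge₀-injective : Injective _≡_ _≡_ edge₀
  edge₀-injective refl = refl
  negIdentityMinor : Minor {suc r} (DCol (suc r) ⊎ ⊤) r
  negIdentityMinor = (suc , suc-injective) , (edge₀ , edge₀-injective)
  det≡-1^r : det (sub (Daug (suc r) a) suc edge₀) ≡ -1ℤ ^ r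
  det≡-1^r = det-negIdentity (sub (Daug (suc r) a) suc edge₀)
               (λ i k → trans (+-identityˡ (- e (suc k) (suc i))) (cong -_ (e-injection suc-injective k i)))
  det≢0 : minorDet (Daug (suc r) a) negIdentityMinor ≢ 0ℤ
  det≢0 det≡0 with () ← i^n≡0⇒i≡0 -1ℤ r (trans (sym det≡-1^r) det≡0)

least-true : ∀ {n} (K : Fin n → Bool) → ∃ (λ v → K v ≡ true) →
             ∃ λ w → K w ≡ true × (∀ v → K v ≡ true → w ≤ᶠ v)
least-true {n} K (v , K-v)
  with ¬∀⟶∃¬-smallest n (λ u → K u ≡ false) (λ u → K u ≟ᵇ false) (λ allFalse → not-¬ K-v (allFalse v))
... | w , K-w≢false , below = w , ¬-not K-w≢false , λ u K-u → ℕ.≮⇒≥ (λ u<w → not-¬ K-u (below-u u<w))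
  where
  below-u : ∀ {u} (u<w : u <ᶠ w) → K u ≡ false
  below-u {u} u<w = subst (λ x → K x ≡ false) (toℕ-injective (trans (toℕ-inject (fromℕ< u<w)) (toℕ-fromℕ< u<w)))
                          (below (fromℕ< u<w))

sumOver : ∀ {n} → (Fin n → Bool) → (Fin n → ℤ) → ℤ
sumOver K a = ∑ (λ v → if K v then a v else 0ℤ)

-- Columns: a, then for
-- every such vertex v the edge from suc w if v ∈ K and from 0 otherwise; suc w is least in K
-- so that these edges are columns of D.
module StarMinor {m} (a : Fin (suc (suc m)) → ℤ) (K : Fin (suc (suc m)) → Bool) (K-0 : K zero ≡ false)
                 (w : Fin (suc m)) (K-w : K (suc w) ≡ true) (w-least : ∀ v → K v ≡ true → suc w ≤ᶠ v) where

  other : Fin m → Fin (suc (suc m))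
  other i = suc (punchIn w i)

  other-injective : Injective _≡_ _≡_ other
  other-injective eq = punchIn-injective w _ _ (suc-injective eq)

  other≢w : ∀ i → other i ≢ suc w
  other≢w i eq = punchInᵢ≢i w i (suc-injective eq)

  rows : Fin (suc m) → Fin (suc (suc m))
  rows zero    = suc w
  rows (suc i) = other i

  rows-injective : Injective _≡_ _≡_ rows
  rows-injective {zero}  {zero}  _  = refl
  rows-injective {zero}  {suc j} eq = contradiction (sym eq) (other≢w j)
  rows-injective {suc i} {zero}  eq = contradiction eq (other≢w i)
  rows-injective {suc i} {suc j} eq = cong suc (other-injective eq)

  source : Fin m → Fin (suc (suc m))
  source l = if K (other l) then suc w else zero

  source<other : ∀ l → source l <ᶠ other l
  source<other l with K (other l) in K-l
  ... | true  = ≤∧≢⇒< (w-least (other l) K-l) (other≢w l ∘ sym)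
  ... | false = s≤s z≤n

  source≢other : ∀ l i → source l ≢ other i
  source≢other l i with K (other l)
  ... | true  = other≢w i ∘ sym
  ... | false = λ ()

  edge : Fin m → DCol (suc (suc m))
  edge l = (source l , other l) , source<other l

  columns : Fin (suc m) → DCol (suc (suc m)) ⊎ ⊤
  columns zero    = inj₂ tt
  columns (suc l) = inj₁ (edge l)

  columns-injective : Injective _≡_ _≡_ columns
  columns-injective {zero}  {zero}  _  = refl
  columns-injective {suc i} {suc j} eq =
    cong suc (other-injective (cong (proj₂ ∘ proj₁) (inj₁-injective eq)))

  starMinor : Minor {suc (suc m)} (DCol (suc (suc m)) ⊎ ⊤) (suc m)
  starMinor = (rows , rows-injective) , (columns , columns-injective)

  S : Square (suc m)
  S = sub (Daug (suc (suc m)) a) rows columns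

  S-lower : ∀ i l → S (suc i) (suc l) ≡ - e l i
  S-lower i l = trans (cong (_- e (other l) (other i)) (e-offDiag (source≢other l i)))
                      (trans (+-identityˡ _) (cong -_ (e-injection other-injective l i)))

  S-top : ∀ l → S zero (suc l) ≡ (if K (other l) then 1ℤ else 0ℤ)
  S-top l with K (other l)
  ... | true  = cong₂ _-_ (e-diag (suc w)) (e-offDiag (other≢w l))
  ... | false = cong (_-_ 0ℤ) (e-offDiag (other≢w l))

  det-S : det S ≡ -1ℤ ^ m * sumOver K a
  det-S = trans (det-bordered S S-lower) (cong (-1ℤ ^ m *_) border≡sumOver)
    where
    open ≡-Reasoning
    f : Fin (suc (suc m)) → ℤ
    f v = if K v then a v else 0ℤ
    select : ∀ b x → (if b then 1ℤ else 0ℤ) * x ≡ (if b then x else 0ℤ)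
    select true  x = *-identityˡ x
    select false x = *-zeroˡ x
    f-other : ∀ k → f (other k) ≡ S zero (suc k) * a (other k)
    f-other k = sym (trans (cong (_* a (other k)) (S-top k)) (select (K (other k)) (a (other k))))
    border≡sumOver : a (suc w) + ∑ (λ k → S zero (suc k) * a (other k)) ≡ sumOver K a
    border≡sumOver = sym (begin
      f zero + ∑ (f ∘ suc)                                 ≡⟨ cong (λ b → (if b then a zero else 0ℤ) + ∑ (f ∘ suc)) K-0 ⟩
      0ℤ + ∑ (f ∘ suc)                                     ≡⟨ +-identityˡ (∑ (f ∘ suc)) ⟩
      ∑ (f ∘ suc)                                          ≡⟨ ∑-remove (f ∘ suc) w ⟩
      f (suc w) + ∑ (f ∘ other)                            ≡⟨ cong₂ _+_ (cong (λ b → if b then a (suc w) else 0ℤ) K-w)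
                                                                        (∑-cong f-other) ⟩
      a (suc w) + ∑ (λ k → S zero (suc k) * a (other k))  ∎)

sumOver-bound : ∀ {m Δ} (a : Fin (suc (suc m)) → ℤ) → IsModular Δ (Daug (suc (suc m)) a) →
                RowsSumToZero (Daug (suc (suc m)) a) → (K : Fin (suc (suc m)) → Bool) → K zero ≡ false →
                ∣ sumOver K a ∣ ≤ Δ
sumOver-bound {m} {Δ} a modular rowsSum K K-0 with any? (λ v → K v ≟ᵇ true)
... | no K-empty = subst (_≤ Δ) (cong ∣_∣ (sym (∑-0 outside))) z≤n
  where
  outside : ∀ v → (if K v then a v else 0ℤ) ≡ 0ℤ
  outside v = cong (λ b → if b then a v else 0ℤ) (¬-not (λ K-v → K-empty (v , K-v)))
... | yes K-inhabited with least-true K K-inhabited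
...   | zero  , K-0′ , _       = contradiction (trans (sym K-0) K-0′) λ ()
...   | suc w , K-w  , w-least = subst (_≤ Δ) ∣det-S∣ (modular (suc m) (Daug-rank (suc m) a rowsSum) starMinor)
  where
  open StarMinor a K K-0 w K-w w-least
  ∣det-S∣ : ∣ det S ∣ ≡ ∣ sumOver K a ∣
  ∣det-S∣ = trans (cong ∣_∣ det-S) (∣-1^n*i∣≡∣i∣ m (sumOver K a))

-- Sign classes of the entries of a

isPositive : ℤ → Bool
isPositive +[1+ _ ] = true
isPositive _        = false

-- An entry +[1+ k ] resp. -[1+ k ] is recorded as k; zeros are dropped.
positives : List ℤ → List ℕ
positives []              = []
positives (+[1+ k ] ∷ xs) = k ∷ positives xs
positives (_ ∷ xs)        = positives xs

negatives : List ℤ → List ℕ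
negatives []              = []
negatives (-[1+ k ] ∷ xs) = k ∷ negatives xs
negatives (_ ∷ xs)        = negatives xs

signed : List ℕ → List ℕ → List ℤ
signed ps ns = map +[1+_] ps ++ map -[1+_] ns

mass : List ℕ → ℕ
mass ks = sum (map suc ks)

supp-↭ : ∀ {n} (a : Fin n → ℤ) → supp a ↭ signed (positives (toList a)) (negatives (toList a))
supp-↭ {zero}  a = ↭-refl
supp-↭ {suc n} a with a zero
... | + zero   = supp-↭ (a ∘ suc)
... | +[1+ k ] = prep +[1+ k ] (supp-↭ (a ∘ suc))
... | -[1+ k ] = ↭-trans (prep -[1+ k ] (supp-↭ (a ∘ suc))) (↭-sym (shift -[1+ k ] (map +[1+_] ps) (map -[1+_] ns)))
  where
  ps = positives (toList (a ∘ suc))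
  ns = negatives (toList (a ∘ suc))

sumOver-positive : ∀ {n} (a : Fin n → ℤ) → sumOver (isPositive ∘ a) a ≡ + mass (positives (toList a))
sumOver-positive {zero}  a = refl
sumOver-positive {suc n} a with a zero
... | + zero   = trans (+-identityˡ _) (sumOver-positive (a ∘ suc))
... | +[1+ k ] = trans (cong (_+_ +[1+ k ]) (sumOver-positive (a ∘ suc)))
                       (sym (pos-+ (suc k) (mass (positives (toList (a ∘ suc))))))
... | -[1+ k ] = trans (+-identityˡ _) (sumOver-positive (a ∘ suc))

sumOver-nonPositive : ∀ {n} (a : Fin n → ℤ) → sumOver (not ∘ isPositive ∘ a) a ≡ - + mass (negatives (toList a))
sumOver-nonPositive {zero}  a = refl
sumOver-nonPositive {suc n} a with a zero
... | + zero   = trans (+-identityˡ _) (sumOver-nonPositive (a ∘ suc))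
... | +[1+ k ] = trans (+-identityˡ _) (sumOver-nonPositive (a ∘ suc))
... | -[1+ k ] = trans (cong (_+_ -[1+ k ]) (sumOver-nonPositive (a ∘ suc)))
                       (sym (trans (cong -_ (pos-+ (suc k) N)) (neg-distrib-+ (+ suc k) (+ N))))
  where N = mass (negatives (toList (a ∘ suc)))

∑-sumOver-split : ∀ {n} (K : Fin n → Bool) (a : Fin n → ℤ) → ∑ a ≡ sumOver K a + sumOver (not ∘ K) a
∑-sumOver-split K a =
  trans (∑-cong split) (∑-distrib-+ (λ v → if K v then a v else 0ℤ) (λ v → if not (K v) then a v else 0ℤ))
  where
  split : ∀ v → a v ≡ (if K v then a v else 0ℤ) + (if not (K v) then a v else 0ℤ)
  split v with K v
  ... | true  = sym (+-identityʳ (a v))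
  ... | false = sym (+-identityˡ (a v))

mass-balance : ∀ {n} (a : Fin n → ℤ) → ∑ a ≡ 0ℤ → mass (positives (toList a)) ≡ mass (negatives (toList a))
mass-balance a ∑a≡0 = +-injective (i-j≡0⇒i≡j _ _ (begin
  + mass (positives (toList a)) - + mass (negatives (toList a))  ≡⟨ cong₂ _+_ (sumOver-positive a) (sumOver-nonPositive a) ⟨
  sumOver (isPositive ∘ a) a + sumOver (not ∘ isPositive ∘ a) a  ≡⟨ ∑-sumOver-split (isPositive ∘ a) a ⟨
  ∑ a                                                            ≡⟨ ∑a≡0 ⟩
  0ℤ                                                             ∎))
  where open ≡-Reasoning

mass-positives≤ : ∀ {m Δ} (a : Fin (suc (suc m)) → ℤ) → IsModular Δ (Daug (suc (suc m)) a) →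
                  RowsSumToZero (Daug (suc (suc m)) a) → mass (positives (toList a)) ≤ Δ
mass-positives≤ {Δ = Δ} a modular rowsSum with isPositive (a zero) in a₀-sign
... | false = subst (_≤ Δ) (cong ∣_∣ (sumOver-positive a)) (sumOver-bound a modular rowsSum (isPositive ∘ a) a₀-sign)
... | true  = subst (_≤ Δ) ∣nonPositive∣ (sumOver-bound a modular rowsSum (not ∘ isPositive ∘ a) (cong not a₀-sign))
  where
  ∣nonPositive∣ : ∣ sumOver (not ∘ isPositive ∘ a) a ∣ ≡ mass (positives (toList a))
  ∣nonPositive∣ = trans (cong ∣_∣ (sumOver-nonPositive a))
                    (trans (∣-i∣≡∣i∣ (+ mass (negatives (toList a)))) (sym (mass-balance a (rowsSum (inj₂ tt)))))

-- Compositions of k ≤ 3, a part n + 1 being recorded as n as in positives.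
data Composition≤3 : List ℕ → ℕ → Set where
  ⟨⟩      : Composition≤3 [] 0
  ⟨1⟩     : Composition≤3 (0 ∷ []) 1
  ⟨2⟩     : Composition≤3 (1 ∷ []) 2
  ⟨1,1⟩   : Composition≤3 (0 ∷ 0 ∷ []) 2
  ⟨3⟩     : Composition≤3 (2 ∷ []) 3
  ⟨1,2⟩   : Composition≤3 (0 ∷ 1 ∷ []) 3
  ⟨2,1⟩   : Composition≤3 (1 ∷ 0 ∷ []) 3
  ⟨1,1,1⟩ : Composition≤3 (0 ∷ 0 ∷ 0 ∷ []) 3

composition≤3 : ∀ ks → mass ks ≤ 3 → Composition≤3 ks (mass ks)
composition≤3 []                    _ = ⟨⟩
composition≤3 (0 ∷ [])              _ = ⟨1⟩
composition≤3 (1 ∷ [])              _ = ⟨2⟩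
composition≤3 (2 ∷ [])              _ = ⟨3⟩
composition≤3 (0 ∷ 0 ∷ [])          _ = ⟨1,1⟩
composition≤3 (0 ∷ 1 ∷ [])          _ = ⟨1,2⟩
composition≤3 (1 ∷ 0 ∷ [])          _ = ⟨2,1⟩
composition≤3 (0 ∷ 0 ∷ 0 ∷ [])      _ = ⟨1,1,1⟩
composition≤3 (suc (suc (suc _)) ∷ _) (s≤s (s≤s (s≤s ())))
composition≤3 (2 ∷ _ ∷ _)           (s≤s (s≤s (s≤s ())))
composition≤3 (1 ∷ suc _ ∷ _)       (s≤s (s≤s (s≤s ())))
composition≤3 (1 ∷ 0 ∷ _ ∷ _)       (s≤s (s≤s (s≤s ())))
composition≤3 (0 ∷ suc (suc _) ∷ _) (s≤s (s≤s (s≤s ())))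
composition≤3 (0 ∷ 1 ∷ _ ∷ _)       (s≤s (s≤s (s≤s ())))
composition≤3 (0 ∷ 0 ∷ suc _ ∷ _)   (s≤s (s≤s (s≤s ())))
composition≤3 (0 ∷ 0 ∷ 0 ∷ _ ∷ _)   (s≤s (s≤s (s≤s ())))

permutation? : (xs ys : List ℤ) → Maybe (xs ↭ ys)
permutation? []       []      = just ↭-refl
permutation? []       (_ ∷ _) = nothing
permutation? (x ∷ xs) ys with x ∈? ys
... | no _     = nothing
... | yes x∈ys with ∈-∃++ x∈ys
...   | us , vs , refl = Maybe.map (λ p → ↭-trans (prep x p) (↭-sym (shift x us vs))) (permutation? xs (us ++ vs))

IsListed : List ℤ → Set
IsListed L = L ≡ L₁ ⊎ L ≡ L₂ ⊎ L ≡ L₃ ⊎ L ≡ L₄ ⊎ L ≡ L₅ ⊎ L ≡ L₆ ⊎ L ≡ L₇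

Listed : List ℤ → Set
Listed xs = Σ ℤ λ s → (s ≡ 1ℤ ⊎ s ≡ -1ℤ) × Σ (List ℤ) λ L → IsListed L × (map (s *_) xs ↭ L)

Listed-↭ : ∀ {xs ys} → xs ↭ ys → Listed ys → Listed xs
Listed-↭ xs↭ys (s , s± , L , L∈ , s·ys↭L) = s , s± , L , L∈ , ↭-trans (map⁺ (s *_) xs↭ys) s·ys↭L

isListed? : ∀ L → Dec (IsListed L)
isListed? L =
  (L ≟L L₁) ⊎-dec (L ≟L L₂) ⊎-dec (L ≟L L₃) ⊎-dec (L ≟L L₄) ⊎-dec (L ≟L L₅) ⊎-dec (L ≟L L₆) ⊎-dec (L ≟L L₇)
  where _≟L_ = ≡-dec _≟ℤ_

-- For closed s, L and xs the implicit arguments evaluate to ⊤ and are filled in automatically.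
listed : ∀ {xs} s L {s± : True ((s ≟ℤ 1ℤ) ⊎-dec (s ≟ℤ -1ℤ))} {L∈ : True (isListed? L)}
         {found : T (is-just (permutation? (map (s *_) xs) L))} → Listed xs
listed {xs} s L {s±} {L∈} {found} =
  s , toWitness s± , L , toWitness L∈ , to-witness-T (permutation? (map (s *_) xs) L) found

classify : ∀ {ps ns k} → Composition≤3 ps k → Composition≤3 ns k →
           Listed (signed ps ns) ⊎ signed ps ns ≡ [] ⊎ length (signed ps ns) ≡ 2
classify ⟨⟩      ⟨⟩      = inj₂ (inj₁ refl)
classify ⟨1⟩     ⟨1⟩     = inj₂ (inj₂ refl)
classify ⟨2⟩     ⟨2⟩     = inj₂ (inj₂ refl)
classify ⟨2⟩     ⟨1,1⟩   = inj₁ (listed -1ℤ L₂)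
classify ⟨1,1⟩   ⟨2⟩     = inj₁ (listed 1ℤ L₂)
classify ⟨1,1⟩   ⟨1,1⟩   = inj₁ (listed 1ℤ L₅)
classify ⟨3⟩     ⟨3⟩     = inj₂ (inj₂ refl)
classify ⟨3⟩     ⟨1,2⟩   = inj₁ (listed -1ℤ L₁)
classify ⟨3⟩     ⟨2,1⟩   = inj₁ (listed -1ℤ L₁)
classify ⟨3⟩     ⟨1,1,1⟩ = inj₁ (listed -1ℤ L₃)
classify ⟨1,2⟩   ⟨3⟩     = inj₁ (listed 1ℤ L₁)
classify ⟨1,2⟩   ⟨1,2⟩   = inj₁ (listed 1ℤ L₄)
classify ⟨1,2⟩   ⟨2,1⟩   = inj₁ (listed 1ℤ L₄)
classify ⟨1,2⟩   ⟨1,1,1⟩ = inj₁ (listed -1ℤ L₆)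
classify ⟨2,1⟩   ⟨3⟩     = inj₁ (listed 1ℤ L₁)
classify ⟨2,1⟩   ⟨1,2⟩   = inj₁ (listed 1ℤ L₄)
classify ⟨2,1⟩   ⟨2,1⟩   = inj₁ (listed 1ℤ L₄)
classify ⟨2,1⟩   ⟨1,1,1⟩ = inj₁ (listed -1ℤ L₆)
classify ⟨1,1,1⟩ ⟨3⟩     = inj₁ (listed 1ℤ L₃)
classify ⟨1,1,1⟩ ⟨1,2⟩   = inj₁ (listed 1ℤ L₆)
classify ⟨1,1,1⟩ ⟨2,1⟩   = inj₁ (listed 1ℤ L₆)
classify ⟨1,1,1⟩ ⟨1,1,1⟩ = inj₁ (listed 1ℤ L₇)

supp≡[]⇒zero : ∀ {n} (a : Fin n → ℤ) → supp a ≡ [] → IsZeroVec a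
supp≡[]⇒zero {suc n} a supp≡[] i with a zero ≟ℤ 0ℤ
supp≡[]⇒zero {suc n} a supp≡[] zero    | yes a₀≡0 = a₀≡0
supp≡[]⇒zero {suc n} a supp≡[] (suc i) | yes _    = supp≡[]⇒zero (a ∘ suc) supp≡[] i
supp≡[]⇒zero {suc n} a ()      i       | no _

supp≡[x]⇒single : ∀ {n} (a : Fin n → ℤ) x → supp a ≡ x ∷ [] →
            ∃ λ i → a i ≡ x × (∀ k → k ≢ i → a k ≡ 0ℤ)
supp≡[x]⇒single {suc n} a x supp≡[x] with a zero ≟ℤ 0ℤ
... | yes a₀≡0 with i , aᵢ≡x , rest ← supp≡[x]⇒single (a ∘ suc) x supp≡[x] =
  suc i , aᵢ≡x , λ { zero _ → a₀≡0 ; (suc k) k≢i → rest k (k≢i ∘ cong suc) }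
... | no _ = zero , ∷-injectiveˡ supp≡[x] ,
  λ { zero 0≢0 → contradiction refl 0≢0 ; (suc k) _ → supp≡[]⇒zero (a ∘ suc) (∷-injectiveʳ supp≡[x]) k }

supp≡[x,y]⇒pair : ∀ {n} (a : Fin n → ℤ) x y → supp a ≡ x ∷ y ∷ [] →
              ∃ λ i → ∃ λ j → i <ᶠ j × a i ≡ x × a j ≡ y × (∀ k → k ≢ i → k ≢ j → a k ≡ 0ℤ)
supp≡[x,y]⇒pair {suc n} a x y supp≡[x,y] with a zero ≟ℤ 0ℤ
... | yes a₀≡0 with i , j , i<j , aᵢ≡x , aⱼ≡y , rest ← supp≡[x,y]⇒pair (a ∘ suc) x y supp≡[x,y] =
  suc i , suc j , s≤s i<j , aᵢ≡x , aⱼ≡y ,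
  λ { zero _ _ → a₀≡0 ; (suc k) k≢i k≢j → rest k (k≢i ∘ cong suc) (k≢j ∘ cong suc) }
... | no _ with j , aⱼ≡y , rest ← supp≡[x]⇒single (a ∘ suc) y (∷-injectiveʳ supp≡[x,y]) =
  zero , suc j , s≤s z≤n , ∷-injectiveˡ supp≡[x,y] , aⱼ≡y ,
  λ { zero 0≢0 _ → contradiction refl 0≢0 ; (suc k) _ k≢j → rest k (k≢j ∘ cong suc) }

∑≡sum-supp : ∀ {n} (a : Fin n → ℤ) → ∑ a ≡ foldr _+_ 0ℤ (supp a)
∑≡sum-supp {zero}  a = refl
∑≡sum-supp {suc n} a with a zero ≟ℤ 0ℤ
... | yes a₀≡0 = trans (cong (_+ ∑ (a ∘ suc)) a₀≡0) (trans (+-identityˡ _) (∑≡sum-supp (a ∘ suc)))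
... | no _     = cong (_+_ (a zero)) (∑≡sum-supp (a ∘ suc))

parallel-edge : ∀ {n} (a : Fin n → ℤ) {i j} (i<j : i <ᶠ j) → a i + a j ≡ 0ℤ →
                (∀ k → k ≢ i → k ≢ j → a k ≡ 0ℤ) → Parallel a (col (D n) ((i , j) , i<j))
parallel-edge a {i} {j} i<j aᵢ+aⱼ≡0 rest = 1ℤ , - a i , (λ { (() , _) }) , vanish
  where
  i≢j : i ≢ j
  i≢j refl = ℕ.<-irrefl refl i<j
  vanish : ∀ k → 1ℤ * a k + - a i * (e i k - e j k) ≡ 0ℤ
  vanish k with k ≟ᶠ i | k ≟ᶠ j
  ... | yes refl | yes refl = contradiction refl i≢j
  ... | yes refl | no k≢j   = trans (cong₂ (λ eᵢ eⱼ → 1ℤ * a k + - a k * (eᵢ - eⱼ)) (e-diag k) (e-offDiag (k≢j ∘ sym)))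
                                    (at-i (a k))
    where
    at-i : ∀ x → 1ℤ * x + - x * (1ℤ - 0ℤ) ≡ 0ℤ
    at-i = solve-∀
  ... | no k≢i   | yes refl = trans (cong₂ (λ eᵢ eⱼ → 1ℤ * a k + - a i * (eᵢ - eⱼ)) (e-offDiag (k≢i ∘ sym)) (e-diag k))
                                    (trans (at-j (a i) (a k)) aᵢ+aⱼ≡0)
    where
    at-j : ∀ x y → 1ℤ * y + - x * (0ℤ - 1ℤ) ≡ x + y
    at-j = solve-∀
  ... | no k≢i   | no k≢j   = begin
    1ℤ * a k + - a i * (e i k - e j k)   ≡⟨ cong₂ (λ aₖ eᵢ → 1ℤ * aₖ + - a i * (eᵢ - e j k)) (rest k k≢i k≢j) (e-offDiag (k≢i ∘ sym)) ⟩
    1ℤ * 0ℤ + - a i * (0ℤ - e j k)       ≡⟨ cong (λ eⱼ → 1ℤ * 0ℤ + - a i * (0ℤ - eⱼ)) (e-offDiag (k≢j ∘ sym)) ⟩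
    1ℤ * 0ℤ + - a i * (0ℤ - 0ℤ)          ≡⟨ elsewhere (a i) ⟩
    0ℤ                                   ∎
    where
    open ≡-Reasoning
    elsewhere : ∀ x → 1ℤ * 0ℤ + - x * (0ℤ - 0ℤ) ≡ 0ℤ
    elsewhere = solve-∀

twoEntries⇒parallel : ∀ {n} (a : Fin n → ℤ) → ∑ a ≡ 0ℤ → length (supp a) ≡ 2 →
                      ∃ λ c → Parallel a (col (D n) c)
twoEntries⇒parallel a ∑a≡0 length≡2 with supp a in supp≡ | ∑≡sum-supp a
... | x ∷ y ∷ [] | ∑a≡x+y with i , j , i<j , aᵢ≡x , aⱼ≡y , rest ← supp≡[x,y]⇒pair a x y supp≡ =
  ((i , j) , i<j) , parallel-edge a i<j aᵢ+aⱼ≡0 rest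
  where
  aᵢ+aⱼ≡0 : a i + a j ≡ 0ℤ
  aᵢ+aⱼ≡0 = trans (cong₂ _+_ aᵢ≡x (trans aⱼ≡y (sym (+-identityʳ y)))) (trans (sym ∑a≡x+y) ∑a≡0)

signCompositions : ∀ {m} (a : Fin (suc (suc m)) → ℤ) → IsModular 3 (Daug (suc (suc m)) a) →
                   RowsSumToZero (Daug (suc (suc m)) a) →
                   ∃ λ k → Composition≤3 (positives (toList a)) k × Composition≤3 (negatives (toList a)) k
signCompositions a modular rowsSum =
  mass ps , composition≤3 ps bound ,
  subst (Composition≤3 ns) (sym balance) (composition≤3 ns (subst (_≤ 3) balance bound))
  where
  ps = positives (toList a)
  ns = negatives (toList a)
  bound : mass ps ≤ 3
  bound = mass-positives≤ a modular rowsSum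
  balance : mass ps ≡ mass ns
  balance = mass-balance a (rowsSum (inj₂ tt))

supp-listed-or-degenerate : ∀ {m} (a : Fin (suc (suc m)) → ℤ) → IsModular 3 (Daug (suc (suc m)) a) →
                            RowsSumToZero (Daug (suc (suc m)) a) →
                            Listed (supp a) ⊎ supp a ≡ [] ⊎ length (supp a) ≡ 2
supp-listed-or-degenerate a modular rowsSum with _ , positive , negative ← signCompositions a modular rowsSum
                                            with classify positive negative
... | inj₁ listed          = inj₁ (Listed-↭ (supp-↭ a) listed)
... | inj₂ (inj₁ ≡[])      = inj₂ (inj₁ (↭-empty-inv (subst (supp a ↭_) ≡[] (supp-↭ a))))
... | inj₂ (inj₂ length≡2) = inj₂ (inj₂ (trans (↭-length (supp-↭ a)) length≡2))

lemma2p5 : (r : ℕ) → 1 ≤ r → (a : Fin (suc r) → ℤ)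
    → IsModular 3 (Daug (suc r) a)
    → NonZeroColumns (Daug (suc r) a)
    → PairwiseNonParallel (Daug (suc r) a)
    → RowsSumToZero (Daug (suc r) a)
    → Σ ℤ λ s → (s ≡ 1ℤ ⊎ s ≡ -1ℤ) × Σ (List ℤ) λ L →
        (L ≡ L₁ ⊎ L ≡ L₂ ⊎ L ≡ L₃ ⊎ L ≡ L₄ ⊎ L ≡ L₅ ⊎ L ≡ L₆ ⊎ L ≡ L₇)
        × (map (s *_) (supp a) ↭ L)
lemma2p5 zero () a
lemma2p5 (suc m) _ a modular nonZero nonParallel rowsSum with supp-listed-or-degenerate a modular rowsSum
... | inj₁ listed          = listed
... | inj₂ (inj₁ supp≡[])  = contradiction (supp≡[]⇒zero a supp≡[]) (nonZero (inj₂ tt))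
... | inj₂ (inj₂ length≡2) with c , parallel ← twoEntries⇒parallel a (rowsSum (inj₂ tt)) length≡2 =
  contradiction parallel (nonParallel (inj₂ tt) (inj₁ c) λ ())
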